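{- If $M$ is a finitely generated free Steiner quasigroup and $f:M\to M$ is a surjective homomorphism, then $f$ is an automorphism of $M$.
   Context: A Steiner quasigroup is a set $M$ with a binary operation $\cdot$ satisfying $x\cdot y=y\cdot x$, $x\cdot x=x$ and $x\cdot(x\cdot y)=y$ for all $x,y$. A Steiner quasigroup $M$ is free if it is freely generated by some subset $X\subseteq M$, i.e. $X$ generates $M$ and for every Steiner quasigroup $N$ every map $X\to N$ extends to a homomorphism $M\to N$. -}

module Defs where

open import Level using (Level; suc; _⊔_)
open import Data.Product using (Σ; ∃; _×_; _,_; proj₁)
open import Data.List using (List)
open import Data.List.Membership.Propositional using (_∈_)
open import Relation.Binary.PropositionalEquality using (_≡_)
open import Function.Definitions using (Injective)

record SteinerQuasigroup : Set₁ where
  infixl 7 _·_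
  field
    Carrier : Set
    _·_     : Carrier → Carrier → Carrier
    comm    : ∀ x y → x · y ≡ y · x
    idem    : ∀ x → x · x ≡ x
    cancel  : ∀ x y → x · (x · y) ≡ y

open SteinerQuasigroup public using (Carrier)

module _ (M N : SteinerQuasigroup) where
  private
    module M = SteinerQuasigroup M
    module N = SteinerQuasigroup N

  IsHom : (Carrier M → Carrier N) → Set
  IsHom f = ∀ x y → f (x M.· y) ≡ f x N.· f y

module _ (M : SteinerQuasigroup) where
  private
    module M = SteinerQuasigroup M

  data Gen (X : Carrier M → Set) : Carrier M → Set where
    base : ∀ {x} → X x → Gen X x
    op   : ∀ {x y} → Gen X x → Gen X y → Gen X (x M.· y)

  Generates : (Carrier M → Set) → Set
  Generates X = ∀ m → Gen X m

  FreelyGeneratedBy : (Carrier M → Set) → Set₁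
  FreelyGeneratedBy X =
    Generates X ×
    ((N : SteinerQuasigroup) (g : Σ (Carrier M) X → Carrier N) →
       Σ (Carrier M → Carrier N) λ h →
         IsHom M N h × (∀ (p : Σ (Carrier M) X) → h (proj₁ p) ≡ g p))

  IsFree : Set₁
  IsFree = Σ (Carrier M → Set) FreelyGeneratedBy

  FinitelyGenerated : Set
  FinitelyGenerated = Σ (List (Carrier M)) λ xs → Generates (_∈ xs)

  Surjective : (Carrier M → Carrier M) → Set
  Surjective f = ∀ y → ∃ λ x → f x ≡ y

  IsAutomorphism : (Carrier M → Carrier M) → Set
  IsAutomorphism f = IsHom M M f × Injective _≡_ _≡_ f × Surjective f

{-# OPTIONS --safe #-}
-- Mal'cev's argument that finitely generated residually finite algebras are Hopfian.
-- For a finite Steiner quasigroup N, a homomorphism M → N is determined by its values on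
-- the finitely many generators, so Hom(M, N) is finite, and precomposition with the
-- surjection f is injective on it, hence onto. Thus every φ : M → N factors as ψ ∘ f,
-- and f a = f b forces φ a = φ b.
-- The free M is residually finite: a set S built up from generators and products is
-- mapped injectively into a finite quotient N one element t at a time. The quotient is
-- replaced by a doubled extension of N (two copies of N and a point ∞) in which a lift of
-- φ stays on the lower copy on S but reaches the upper copy at t; when no such lift exists,
-- t already lies in S.
module Submission where

open import Defs
open import Data.Bool as Bool using (Bool; true; false; not; T; _xor_)
open import Data.Bool.Properties using (∧-comm; not-involutive)
open import Data.Fin as Fin using (Fin)
open import Data.List as List using (List; []; _∷_; map; _++_; length; filter; cartesianProductWith)
open import Data.List.Properties using (filter-notAll)
open import Data.List.Membership.Propositional using (_∈_)
open import Data.List.Membership.Propositional.Properties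
  using (∈-map⁺; ∈-map⁻; ∈-++⁺ˡ; ∈-++⁺ʳ; ∈-filter⁺; ∈-filter⁻; ∈-cartesianProductWith⁺; ∈-deduplicate⁺; ∈-deduplicate⁻)
import Data.List.Membership.DecPropositional as DecMembership
open import Data.List.Relation.Binary.Subset.Propositional using (_⊆_)
import Data.List.Relation.Binary.Subset.Propositional.Properties as Subset
import Data.List.Relation.Unary.All as All
open import Data.List.Relation.Unary.Any as Any using (here; there; index)
open import Data.List.Relation.Unary.Any.Properties using (lookup-index)
open import Data.List.Relation.Unary.Unique.Propositional using (Unique; []; _∷_)
open import Data.List.Relation.Unary.Unique.DecPropositional.Properties using (deduplicate-!)
open import Data.Nat using (ℕ; zero; suc; _≤_; _<_; z≤n)
open import Data.Nat.Properties using (≤-<-trans; <-irrefl)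
open import Data.Product using (Σ; _×_; _,_; proj₁; proj₂; uncurry)
open import Data.Sum using (_⊎_; inj₁; inj₂)
open import Data.Unit using (⊤; tt)
open import Data.Vec as Vec using (Vec; []; _∷_; lookup; tabulate)
open import Data.Vec.Properties using (lookup-map; map-cong; lookup∘tabulate)
import Data.Vec.Properties as Vecₚ
open import Function using (_∘_; id)
open import Relation.Binary.Definitions using (DecidableEquality)
open import Relation.Binary.PropositionalEquality
open import Relation.Nullary using (Dec; yes; no; ¬_; does; contradiction)
open import Relation.Nullary.Decidable using (map′; _×-dec_; ¬?; dec-true; dec-false; isYes; isYes≗does; toWitness)

InjectiveOn : {A B : Set} → List A → (A → B) → Set
InjectiveOn us h = ∀ {u v} → u ∈ us → v ∈ us → h u ≡ h v → u ≡ v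

module Pigeonhole {B : Set} (_≟_ : DecidableEquality B) where
  open DecMembership _≟_ using (_∈?_)

  private
    _-_ : List B → B → List B
    ws - t = filter (λ w → ¬? (w ≟ t)) ws

    length-< : ∀ {t ws} → t ∈ ws → length (ws - t) < length ws
    length-< t∈ws = filter-notAll _ _ (Any.map (λ t≡w w≢t → w≢t (sym t≡w)) t∈ws)

  injective⇒length≤ : {A : Set} (h : A → B) {us : List A} {ws : List B} → Unique us →
    (∀ {u} → u ∈ us → h u ∈ ws) → InjectiveOn us h → length us ≤ length ws
  injective⇒length≤ h [] _ _ = z≤n
  injective⇒length≤ h {u ∷ us} {ws} (u∉us ∷ us!) into inj =
    ≤-<-trans (injective⇒length≤ h us! into′ (λ p q → inj (there p) (there q)))
              (length-< (into (here refl)))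
    where
    into′ : ∀ {v} → v ∈ us → h v ∈ ws - h u
    into′ v∈us = ∈-filter⁺ _ (into (there v∈us))
      (λ hv≡hu → All.lookup u∉us v∈us (sym (inj (there v∈us) (here refl) hv≡hu)))

  unique-injective⇒surjective : (h : B → B) {us : List B} → Unique us → (∀ {u} → u ∈ us → h u ∈ us) →
    InjectiveOn us h → ∀ {t} → t ∈ us → t ∈ map h us
  unique-injective⇒surjective h {us} us! into inj {t} t∈us with t ∈? map h us
  ... | yes t∈hus = t∈hus
  ... | no t∉hus = contradiction (≤-<-trans (injective⇒length≤ h us! into′ inj) (length-< t∈us)) (<-irrefl refl)
    where
    into′ : ∀ {u} → u ∈ us → h u ∈ us - t
    into′ u∈us = ∈-filter⁺ _ (into u∈us) (λ hu≡t → t∉hus (subst (_∈ map h us) hu≡t (∈-map⁺ h u∈us)))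

  injective⇒surjective : (h : B → B) (us : List B) → (∀ {u} → u ∈ us → h u ∈ us) →
    InjectiveOn us h → ∀ {t} → t ∈ us → t ∈ map h us
  injective⇒surjective h us into inj t∈us =
    Subset.map⁺ h (∈-deduplicate⁻ _≟_ us)
      (unique-injective⇒surjective h (deduplicate-! _≟_ us)
        (λ u∈ds → ∈-deduplicate⁺ _≟_ (into (∈-deduplicate⁻ _≟_ us u∈ds)))
        (λ p q → inj (∈-deduplicate⁻ _≟_ us p) (∈-deduplicate⁻ _≟_ us q))
        (∈-deduplicate⁺ _≟_ t∈us))

vectors : {A : Set} → List A → (n : ℕ) → List (Vec A n)
vectors xs zero    = [] ∷ []
vectors xs (suc n) = cartesianProductWith _∷_ xs (vectors xs n)

∈-vectors : {A : Set} {xs : List A} → (∀ x → x ∈ xs) → ∀ {n} (ρ : Vec A n) → ρ ∈ vectors xs n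
∈-vectors complete []      = here refl
∈-vectors complete (x ∷ ρ) = ∈-cartesianProductWith⁺ _∷_ (complete x) (∈-vectors complete ρ)

record FiniteSteinerQuasigroup : Set₁ where
  field
    quasigroup : SteinerQuasigroup
    _≟_        : DecidableEquality (Carrier quasigroup)
    elements   : List (Carrier quasigroup)
    complete   : ∀ x → x ∈ elements

trivial : FiniteSteinerQuasigroup
trivial = record
  { quasigroup = record { Carrier = ⊤ ; _·_ = λ _ _ → tt ; comm = λ _ _ → refl ; idem = λ _ → refl ; cancel = λ _ _ → refl }
  ; _≟_        = λ _ _ → yes refl
  ; elements   = tt ∷ []
  ; complete   = λ _ → here refl
  }

IsHom-∘ : ∀ L M N {g : Carrier M → Carrier N} {h : Carrier L → Carrier M} →
  IsHom M N g → IsHom L M h → IsHom L N (g ∘ h)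
IsHom-∘ L M N {g} {h} g-hom h-hom x y = trans (cong g (h-hom x y)) (g-hom (h x) (h y))

module _ (M N : SteinerQuasigroup) {h₁ h₂ : Carrier M → Carrier N}
         (h₁-hom : IsHom M N h₁) (h₂-hom : IsHom M N h₂) where
  open SteinerQuasigroup N using (_·_)

  homs-agree-on-Gen : ∀ {G} → (∀ {x} → G x → h₁ x ≡ h₂ x) → ∀ {m} → Gen M G m → h₁ m ≡ h₂ m
  homs-agree-on-Gen agree (base x) = agree x
  homs-agree-on-Gen agree (op {x} {y} gx gy) =
    trans (h₁-hom x y)
      (trans (cong₂ _·_ (homs-agree-on-Gen agree gx) (homs-agree-on-Gen agree gy)) (sym (h₂-hom x y)))

module FreeExtension {M : SteinerQuasigroup} {X : Carrier M → Set} (free : FreelyGeneratedBy M X)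
  (N : SteinerQuasigroup) (g : Carrier M → Carrier N) where

  private
    extension : Σ (Carrier M → Carrier N) λ h → IsHom M N h × (∀ (x : Σ (Carrier M) X) → h (proj₁ x) ≡ g (proj₁ x))
    extension = proj₂ free N (g ∘ proj₁)

  extend : Carrier M → Carrier N
  extend = proj₁ extension

  extend-hom : IsHom M N extend
  extend-hom = proj₁ (proj₂ extension)

  extend-generator : ∀ {x} → X x → extend x ≡ g x
  extend-generator x = proj₂ (proj₂ extension) (_ , x)

module SteinerProperties (N : SteinerQuasigroup) where
  open SteinerQuasigroup N

  y·[x·y]≡x : ∀ x y → y · (x · y) ≡ x
  y·[x·y]≡x x y = trans (cong (y ·_) (comm x y)) (cancel y x)

  [x·y]·y≡x : ∀ x y → (x · y) · y ≡ x
  [x·y]·y≡x x y = trans (comm (x · y) y) (y·[x·y]≡x x y)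

  [x·y]·x≡y : ∀ x y → (x · y) · x ≡ y
  [x·y]·x≡y x y = trans (comm (x · y) x) (cancel x y)

  line : Carrier N → Carrier N → List (Carrier N)
  line x y = x ∷ y ∷ x · y ∷ []

  pattern ₁ = here refl
  pattern ₂ = there (here refl)
  pattern ₃ = there (there (here refl))
  pattern ₄ = there (there (there ()))

  third : ∀ {x y z} → z ≡ x · y → z ∈ line x y
  third z≡x·y = there (there (here z≡x·y))

  line-closed : ∀ {x y u v} → u ∈ line x y → v ∈ line x y → u · v ∈ line x y
  line-closed {x} {y} ₁ ₁ = here (idem x)
  line-closed {x} {y} ₁ ₂ = ₃
  line-closed {x} {y} ₁ ₃ = there (here (cancel x y))
  line-closed {x} {y} ₂ ₁ = third (comm y x)
  line-closed {x} {y} ₂ ₂ = there (here (idem y))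
  line-closed {x} {y} ₂ ₃ = here (y·[x·y]≡x x y)
  line-closed {x} {y} ₃ ₁ = there (here ([x·y]·x≡y x y))
  line-closed {x} {y} ₃ ₂ = here ([x·y]·y≡x x y)
  line-closed {x} {y} ₃ ₃ = third (idem (x · y))
  line-closed ₄ _
  line-closed _ ₄

  line-⊆ : ∀ {x y} {L : List (Carrier N)} → x ∈ L → y ∈ L → x · y ∈ L → line x y ⊆ L
  line-⊆ x∈L y∈L xy∈L ₁ = x∈L
  line-⊆ x∈L y∈L xy∈L ₂ = y∈L
  line-⊆ x∈L y∈L xy∈L ₃ = xy∈L
  line-⊆ x∈L y∈L xy∈L ₄

  line-through : ∀ {x y u v} → u ∈ line x y → v ∈ line x y → u ≢ v → x ∈ line u v × y ∈ line u v
  line-through {x} {y} ₁ ₂ _ = ₁ , ₂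
  line-through {x} {y} ₁ ₃ _ = ₁ , third (sym (cancel x y))
  line-through {x} {y} ₂ ₁ _ = ₂ , ₁
  line-through {x} {y} ₂ ₃ _ = third (sym (y·[x·y]≡x x y)) , ₁
  line-through {x} {y} ₃ ₁ _ = ₂ , third (sym ([x·y]·x≡y x y))
  line-through {x} {y} ₃ ₂ _ = third (sym ([x·y]·y≡x x y)) , ₂
  line-through ₁ ₁ u≢v = contradiction refl u≢v
  line-through ₂ ₂ u≢v = contradiction refl u≢v
  line-through ₃ ₃ u≢v = contradiction refl u≢v
  line-through ₄ _ _
  line-through _ ₄ _

  line-⊆-line : ∀ {x y u v} → u ∈ line x y → v ∈ line x y → u ≢ v → line x y ⊆ line u v
  line-⊆-line u∈ v∈ u≢v with x∈ , y∈ ← line-through u∈ v∈ u≢v = line-⊆ x∈ y∈ (line-closed x∈ y∈)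

data Doubled (A : Set) : Set where
  pt : Bool → A → Doubled A
  ∞  : Doubled A

module _ {A : Set} where

  pt-injective : ∀ {a b} {x y : A} → pt a x ≡ pt b y → a ≡ b × x ≡ y
  pt-injective refl = refl , refl

  ≡-dec : DecidableEquality A → DecidableEquality (Doubled A)
  ≡-dec _≟_ (pt a x) (pt b y) = map′ (uncurry (cong₂ pt)) pt-injective ((a Bool.≟ b) ×-dec (x ≟ y))
  ≡-dec _≟_ (pt _ _) ∞        = no λ ()
  ≡-dec _≟_ ∞        (pt _ _) = no λ ()
  ≡-dec _≟_ ∞        ∞        = yes refl

  doubledElements : List A → List (Doubled A)
  doubledElements xs = ∞ ∷ map (pt false) xs ++ map (pt true) xs

  ∈-doubledElements : {xs : List A} → (∀ x → x ∈ xs) → ∀ u → u ∈ doubledElements xs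
  ∈-doubledElements complete ∞           = here refl
  ∈-doubledElements complete (pt false x) = there (∈-++⁺ˡ (∈-map⁺ (pt false) (complete x)))
  ∈-doubledElements complete (pt true x)  = there (∈-++⁺ʳ _ (∈-map⁺ (pt true) (complete x)))

private
  xor-swap : ∀ a b k → a xor (b xor k) ≡ b xor (a xor k)
  xor-swap false b     k = refl
  xor-swap true  false k = refl
  xor-swap true  true  k = refl

  xor-cancel : ∀ a b k → a xor ((a xor b xor k) xor k) ≡ b
  xor-cancel false false false = refl
  xor-cancel false false true  = refl
  xor-cancel false true  false = refl
  xor-cancel false true  true  = refl
  xor-cancel true  false false = refl
  xor-cancel true  false true  = refl
  xor-cancel true  true  false = refl
  xor-cancel true  true  true  = refl

-- Over each x the points pt false x, pt true x and ∞ form a line; over distinct x and y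
-- the levels add up modulo 2, shifted by c x y. The shift makes a level-false lift of a
-- map into F rise exactly at products of two distinct points of Bs.
module Doubling (F : FiniteSteinerQuasigroup)
  (Bs : List (Carrier (FiniteSteinerQuasigroup.quasigroup F)))
  (Bs-closed : ∀ {x y} → x ∈ Bs → y ∈ Bs → SteinerQuasigroup._·_ (FiniteSteinerQuasigroup.quasigroup F) x y ∈ Bs)
  where

  open FiniteSteinerQuasigroup F
  open SteinerQuasigroup quasigroup
  open DecMembership _≟_ using (_∈?_)

  private
    A : Set
    A = Carrier quasigroup

  c : A → A → Bool
  c x y = does (x ∈? Bs ×-dec y ∈? Bs)

  c-comm : ∀ x y → c x y ≡ c y x
  c-comm x y = ∧-comm (does (x ∈? Bs)) (does (y ∈? Bs))

  c-cancel : ∀ x y → c x (x · y) ≡ c x y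
  c-cancel x y with x ∈? Bs | y ∈? Bs | (x · y) ∈? Bs
  ... | no _     | _        | _         = refl
  ... | yes _    | yes _    | yes _     = refl
  ... | yes _    | no _     | no _      = refl
  ... | yes x∈   | yes y∈   | no xy∉    = contradiction (Bs-closed x∈ y∈) xy∉
  ... | yes x∈   | no y∉    | yes xy∈   = contradiction (subst (_∈ Bs) (cancel x y) (Bs-closed x∈ xy∈)) y∉

  sameFibre : Bool → Bool → A → Doubled A
  sameFibre false false x = pt false x
  sameFibre true  true  x = pt true x
  sameFibre _     _     _ = ∞

  sameFibre-comm : ∀ a b x → sameFibre a b x ≡ sameFibre b a x
  sameFibre-comm false false x = refl
  sameFibre-comm false true  x = refl
  sameFibre-comm true  false x = refl
  sameFibre-comm true  true  x = refl

  private
    ptProduct : Bool → Bool → (x y : A) → Dec (x ≡ y) → Doubled A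
    ptProduct a b x y (yes _) = sameFibre a b x
    ptProduct a b x y (no _)  = pt (a xor b xor c x y) (x · y)

  _∙_ : Doubled A → Doubled A → Doubled A
  pt a x ∙ pt b y = ptProduct a b x y (x ≟ y)
  pt a x ∙ ∞      = pt (not a) x
  ∞      ∙ pt b y = pt (not b) y
  ∞      ∙ ∞      = ∞

  ∙-same : ∀ a b x → pt a x ∙ pt b x ≡ sameFibre a b x
  ∙-same a b x = go (x ≟ x)
    where
    go : (d : Dec (x ≡ x)) → ptProduct a b x x d ≡ sameFibre a b x
    go (yes _)  = refl
    go (no x≢x) = contradiction refl x≢x

  ∙-distinct : ∀ a b {x y} → x ≢ y → pt a x ∙ pt b y ≡ pt (a xor b xor c x y) (x · y)
  ∙-distinct a b {x} {y} x≢y = go (x ≟ y)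
    where
    go : (d : Dec (x ≡ y)) → ptProduct a b x y d ≡ pt (a xor b xor c x y) (x · y)
    go (yes x≡y) = contradiction x≡y x≢y
    go (no _)    = refl

  ∙-comm : ∀ u v → u ∙ v ≡ v ∙ u
  ∙-comm (pt a x) (pt b y) = go (x ≟ y)
    where
    open ≡-Reasoning
    go : Dec (x ≡ y) → pt a x ∙ pt b y ≡ pt b y ∙ pt a x
    go (yes refl) = trans (∙-same a b x) (trans (sameFibre-comm a b x) (sym (∙-same b a x)))
    go (no x≢y) = begin
      pt a x ∙ pt b y                   ≡⟨ ∙-distinct a b x≢y ⟩
      pt (a xor b xor c x y) (x · y)    ≡⟨ cong₂ pt (trans (xor-swap a b _) (cong (λ k → b xor a xor k) (c-comm x y))) (comm x y) ⟩
      pt (b xor a xor c y x) (y · x)    ≡⟨ sym (∙-distinct b a (x≢y ∘ sym)) ⟩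
      pt b y ∙ pt a x                   ∎
  ∙-comm (pt a x) ∞        = refl
  ∙-comm ∞        (pt b y) = refl
  ∙-comm ∞        ∞        = refl

  ∙-idem : ∀ u → u ∙ u ≡ u
  ∙-idem (pt false x) = ∙-same false false x
  ∙-idem (pt true x)  = ∙-same true true x
  ∙-idem ∞            = refl

  ∙-cancel : ∀ u v → u ∙ (u ∙ v) ≡ v
  ∙-cancel (pt a x) (pt b y) = go (x ≟ y)
    where
    open ≡-Reasoning
    go : Dec (x ≡ y) → pt a x ∙ (pt a x ∙ pt b y) ≡ pt b y
    go (yes refl) = trans (cong (pt a x ∙_) (∙-same a b x)) (same-fibre a b)
      where
      same-fibre : ∀ a b → pt a x ∙ sameFibre a b x ≡ pt b x
      same-fibre false false = ∙-idem (pt false x)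
      same-fibre true  true  = ∙-idem (pt true x)
      same-fibre false true  = refl
      same-fibre true  false = refl
    go (no x≢y) = begin
      pt a x ∙ (pt a x ∙ pt b y)                          ≡⟨ cong (pt a x ∙_) (∙-distinct a b x≢y) ⟩
      pt a x ∙ pt (a xor b xor c x y) (x · y)             ≡⟨ ∙-distinct a _ x≢x·y ⟩
      pt (a xor (a xor b xor c x y) xor c x (x · y)) (x · (x · y))
        ≡⟨ cong₂ pt (trans (cong (λ k → a xor (a xor b xor c x y) xor k) (c-cancel x y)) (xor-cancel a b _)) (cancel x y) ⟩
      pt b y                                              ∎
      where
      x≢x·y : x ≢ x · y
      x≢x·y x≡x·y = x≢y (trans (sym (idem x)) (trans (cong (x ·_) x≡x·y) (cancel x y)))
  ∙-cancel (pt false x) ∞        = ∙-same false true x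
  ∙-cancel (pt true  x) ∞        = ∙-same true false x
  ∙-cancel ∞            (pt b y) = cong (λ b′ → pt b′ y) (not-involutive b)
  ∙-cancel ∞            ∞        = refl

  doubled : FiniteSteinerQuasigroup
  doubled = record
    { quasigroup = record { Carrier = Doubled A ; _·_ = _∙_ ; comm = ∙-comm ; idem = ∙-idem ; cancel = ∙-cancel }
    ; _≟_        = ≡-dec _≟_
    ; elements   = doubledElements elements
    ; complete   = ∈-doubledElements complete
    }

  lowered-product : ∀ {x y} → (x ≢ y → ¬ (x ∈ Bs × y ∈ Bs)) → pt false x ∙ pt false y ≡ pt false (x · y)
  lowered-product {x} {y} not-crossing = go (x ≟ y)
    where
    go : Dec (x ≡ y) → pt false x ∙ pt false y ≡ pt false (x · y)
    go (yes refl) = trans (∙-idem (pt false x)) (cong (pt false) (sym (idem x)))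
    go (no x≢y)   = trans (∙-distinct false false x≢y)
      (cong (λ b → pt b (x · y)) (dec-false (x ∈? Bs ×-dec y ∈? Bs) (not-crossing x≢y)))

  raised-product : ∀ {x y} → x ≢ y → x ∈ Bs → y ∈ Bs → pt false x ∙ pt false y ≡ pt true (x · y)
  raised-product {x} {y} x≢y x∈ y∈ =
    trans (∙-distinct false false x≢y) (cong (λ b → pt b (x · y)) (dec-true (x ∈? Bs ×-dec y ∈? Bs) (x∈ , y∈)))

infixl 7 _⊙_
data Term (n : ℕ) : Set where
  var : Fin n → Term n
  _⊙_ : Term n → Term n → Term n

module _ {n : ℕ} where

  var-injective : ∀ {i j : Fin n} → var i ≡ var j → i ≡ j
  var-injective refl = refl

  ⊙-injective : ∀ {s t s′ t′ : Term n} → s ⊙ t ≡ s′ ⊙ t′ → s ≡ s′ × t ≡ t′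
  ⊙-injective refl = refl , refl

  _≟ᵀ_ : DecidableEquality (Term n)
  var i   ≟ᵀ var j     = map′ (cong var) var-injective (i Fin.≟ j)
  var _   ≟ᵀ (_ ⊙ _)   = no λ ()
  (_ ⊙ _) ≟ᵀ var _     = no λ ()
  (s ⊙ t) ≟ᵀ (s′ ⊙ t′) = map′ (uncurry (cong₂ _⊙_)) ⊙-injective ((s ≟ᵀ s′) ×-dec (t ≟ᵀ t′))

  eval : (N : SteinerQuasigroup) → Vec (Carrier N) n → Term n → Carrier N
  eval N ρ (var i) = lookup ρ i
  eval N ρ (s ⊙ t) = SteinerQuasigroup._·_ N (eval N ρ s) (eval N ρ t)

  eval-hom : ∀ {M N} {h : Carrier M → Carrier N} → IsHom M N h →
    ∀ ρ t → eval N (Vec.map h ρ) t ≡ h (eval M ρ t)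
  eval-hom {N = N} h-hom ρ (var i) = lookup-map i _ ρ
  eval-hom {N = N} h-hom ρ (s ⊙ t) =
    trans (cong₂ (SteinerQuasigroup._·_ N) (eval-hom h-hom ρ s) (eval-hom h-hom ρ t)) (sym (h-hom _ _))

-- A proof of Generates chooses a term for every element, so equality is decidable by
-- comparing the chosen terms.
module Coding (M : SteinerQuasigroup) (xs : List (Carrier M)) (xs-gen : Generates M (_∈ xs)) where
  open SteinerQuasigroup M using (_·_)

  k : ℕ
  k = length xs

  generators : Vec (Carrier M) k
  generators = tabulate (List.lookup xs)

  termOf : ∀ {m} → Gen M (_∈ xs) m → Term k
  termOf (base m∈xs) = var (index m∈xs)
  termOf (op g h)    = termOf g ⊙ termOf h

  eval-termOf : ∀ {m} (g : Gen M (_∈ xs) m) → eval M generators (termOf g) ≡ m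
  eval-termOf (base m∈xs) = trans (lookup∘tabulate _ (index m∈xs)) (sym (lookup-index m∈xs))
  eval-termOf (op g h)    = cong₂ _·_ (eval-termOf g) (eval-termOf h)

  code : Carrier M → Term k
  code m = termOf (xs-gen m)

  eval-code : ∀ m → eval M generators (code m) ≡ m
  eval-code m = eval-termOf (xs-gen m)

  code-injective : ∀ {u v} → code u ≡ code v → u ≡ v
  code-injective {u} {v} eq = trans (sym (eval-code u)) (trans (cong (eval M generators) eq) (eval-code v))

  _≟_ : DecidableEquality (Carrier M)
  u ≟ v = map′ code-injective (cong code) (code u ≟ᵀ code v)

-- Homomorphisms M → N are represented by their values on the generating list: the
-- realisable vectors are exactly these.
module Hopfian (M : SteinerQuasigroup) {X : Carrier M → Set} (free : FreelyGeneratedBy M X)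
  (xs : List (Carrier M)) (xs-gen : Generates M (_∈ xs))
  {f : Carrier M → Carrier M} (f-hom : IsHom M M f) (f-surj : Surjective M f)
  (F : FiniteSteinerQuasigroup) where

  open FiniteSteinerQuasigroup F renaming (quasigroup to N)
  open Coding M xs xs-gen using (k; generators; code; eval-code)

  private
    A : Set
    A = Carrier N

  homOf : Vec A k → Carrier M → A
  homOf ρ = FreeExtension.extend free N (λ x → eval N ρ (code x))

  homOf-hom : ∀ ρ → IsHom M N (homOf ρ)
  homOf-hom ρ = FreeExtension.extend-hom free N (λ x → eval N ρ (code x))

  restrict : (Carrier M → A) → Vec A k
  restrict h = Vec.map h generators

  homOf-restrict : ∀ {h} → IsHom M N h → ∀ m → homOf (restrict h) m ≡ h m
  homOf-restrict {h} h-hom m = homs-agree-on-Gen M N (homOf-hom (restrict h)) h-hom on-generators (proj₁ free m)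
    where
    open ≡-Reasoning
    on-generators : ∀ {x} → X x → homOf (restrict h) x ≡ h x
    on-generators {x} x∈X = begin
      homOf (restrict h) x                    ≡⟨ FreeExtension.extend-generator free N _ x∈X ⟩
      eval N (Vec.map h generators) (code x)  ≡⟨ eval-hom h-hom generators (code x) ⟩
      h (eval M generators (code x))          ≡⟨ cong h (eval-code x) ⟩
      h x                                     ∎

  pullback : Vec A k → Vec A k
  pullback ρ = restrict (homOf ρ ∘ f)

  homOf-pullback : ∀ ρ m → homOf (pullback ρ) m ≡ homOf ρ (f m)
  homOf-pullback ρ = homOf-restrict (IsHom-∘ M M N (homOf-hom ρ) f-hom)

  realisable : List (Vec A k)
  realisable = filter (λ ρ → Vecₚ.≡-dec _≟_ (restrict (homOf ρ)) ρ) (vectors elements k)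

  restrict-realisable : ∀ {h} → IsHom M N h → restrict h ∈ realisable
  restrict-realisable {h} h-hom =
    ∈-filter⁺ _ (∈-vectors complete (restrict h)) (map-cong (homOf-restrict h-hom) generators)

  pullback-injective : InjectiveOn realisable pullback
  pullback-injective {ρ} {ρ′} ρ∈ ρ′∈ eq = begin
    ρ                     ≡⟨ sym (proj₂ (∈-filter⁻ _ {xs = vectors elements k} ρ∈)) ⟩
    restrict (homOf ρ)    ≡⟨ map-cong homOf-agree generators ⟩
    restrict (homOf ρ′)   ≡⟨ proj₂ (∈-filter⁻ _ {xs = vectors elements k} ρ′∈) ⟩
    ρ′                    ∎
    where
    open ≡-Reasoning
    homOf-agree : ∀ m → homOf ρ m ≡ homOf ρ′ m
    homOf-agree m with m₀ , refl ← f-surj m =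
      trans (sym (homOf-pullback ρ m₀)) (trans (cong (λ σ → homOf σ m₀) eq) (homOf-pullback ρ′ m₀))

  restrict-∈-pullbacks : ∀ {φ} → IsHom M N φ → restrict φ ∈ map pullback realisable
  restrict-∈-pullbacks φ-hom = injective⇒surjective pullback realisable
    (λ _ → restrict-realisable (IsHom-∘ M M N (homOf-hom _) f-hom)) pullback-injective (restrict-realisable φ-hom)
    where open Pigeonhole (Vecₚ.≡-dec _≟_) using (injective⇒surjective)

  factor : ∀ {φ} → IsHom M N φ → Σ (Carrier M → A) λ ψ → IsHom M N ψ × (∀ m → φ m ≡ ψ (f m))
  factor {φ} φ-hom with ρ , _ , restrict-φ≡pullback-ρ ← ∈-map⁻ pullback (restrict-∈-pullbacks φ-hom) =
    homOf ρ , homOf-hom ρ , λ m → begin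
      φ m                         ≡⟨ sym (homOf-restrict φ-hom m) ⟩
      homOf (restrict φ) m        ≡⟨ cong (λ σ → homOf σ m) restrict-φ≡pullback-ρ ⟩
      homOf (pullback ρ) m        ≡⟨ homOf-pullback ρ m ⟩
      homOf ρ (f m)               ∎
    where open ≡-Reasoning

module ResidualFiniteness (M : SteinerQuasigroup) {X : Carrier M → Set} (free : FreelyGeneratedBy M X)
  (_≟_ : DecidableEquality (Carrier M)) where

  open SteinerQuasigroup M using (_·_; idem)
  open SteinerProperties M using (line; line-closed; line-⊆)
  open FiniteSteinerQuasigroup using (quasigroup)

  data Derivation : List (Carrier M) → Set where
    []  : Derivation []
    gen : ∀ {S x} → X x → Derivation S → Derivation (x ∷ S)
    mul : ∀ {S p q} → p ∈ S → q ∈ S → Derivation S → Derivation (p · q ∷ S)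

  record Approximation : Set₁ where
    field
      support     : List (Carrier M)
      derivation  : Derivation support
      target      : FiniteSteinerQuasigroup
      φ           : Carrier M → Carrier (quasigroup target)
      φ-hom       : IsHom M (quasigroup target) φ
      φ-injective : InjectiveOn support φ

  open Approximation using (support; derivation; target; φ-injective)

  Enlargement : Approximation → Carrier M → Set₁
  Enlargement α t = Σ Approximation λ α′ → support α ⊆ support α′ × t ∈ support α′

  module _ (α : Approximation) where
    open Approximation α using (φ; φ-hom)
    open FiniteSteinerQuasigroup (target α) using () renaming (quasigroup to N; _≟_ to _≟ᴺ_)
    open SteinerQuasigroup N using () renaming (_·_ to _·ᴺ_)
    open SteinerProperties N using ()
      renaming (line to lineᴺ; line-closed to lineᴺ-closed; line-⊆-line to lineᴺ-⊆-lineᴺ)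
    open DecMembership _≟ᴺ_ using (_∈?_)

    module Lifting (Bs : List (Carrier N)) (Bs-closed : ∀ {x y} → x ∈ Bs → y ∈ Bs → x ·ᴺ y ∈ Bs)
      (G : Carrier M → Bool) where

      open Doubling (target α) Bs Bs-closed public
      open FreeExtension free (quasigroup doubled) (λ x → pt (G x) (φ x))
        renaming (extend to ψ; extend-hom to ψ-hom; extend-generator to ψ-generator) public

      Low : Carrier M → Set
      Low u = ψ u ≡ pt false (φ u)

      data Obstruction (S : List (Carrier M)) : Set where
        raised   : ∀ {y} → y ∈ S → T (G y) → Obstruction S
        crossing : ∀ {v w} → line v w ⊆ S → φ v ≢ φ w → φ v ∈ Bs → φ w ∈ Bs → Obstruction S

      weaken : ∀ {S z} → Obstruction S → Obstruction (z ∷ S)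
      weaken (raised y∈ Gy)          = raised (there y∈) Gy
      weaken (crossing L⊆ v≢w v∈ w∈) = crossing (there ∘ L⊆) v≢w v∈ w∈

      low-product : ∀ {p q} → Low p → Low q → (φ p ≢ φ q → ¬ (φ p ∈ Bs × φ q ∈ Bs)) → Low (p · q)
      low-product {p} {q} low-p low-q not-crossing = begin
        ψ (p · q)                       ≡⟨ ψ-hom p q ⟩
        ψ p ∙ ψ q                       ≡⟨ cong₂ _∙_ low-p low-q ⟩
        pt false (φ p) ∙ pt false (φ q) ≡⟨ lowered-product not-crossing ⟩
        pt false (φ p ·ᴺ φ q)           ≡⟨ cong (pt false) (sym (φ-hom p q)) ⟩
        pt false (φ (p · q))            ∎
        where open ≡-Reasoning

      low-or-obstructed : ∀ {S} → Derivation S → (∀ {u} → u ∈ S → Low u) ⊎ Obstruction S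
      low-or-obstructed [] = inj₁ λ ()
      low-or-obstructed (gen {x = x} x∈X d) with low-or-obstructed d | G x in Gx
      ... | inj₂ o   | _     = inj₂ (weaken o)
      ... | inj₁ _   | true  = inj₂ (raised (here refl) (subst T (sym Gx) tt))
      ... | inj₁ low | false = inj₁ λ where
        (here refl) → trans (ψ-generator x∈X) (cong (λ b → pt b (φ x)) Gx)
        (there u∈)  → low u∈
      low-or-obstructed (mul {p = p} {q} p∈ q∈ d) with low-or-obstructed d
      ... | inj₂ o   = inj₂ (weaken o)
      ... | inj₁ low with φ p ≟ᴺ φ q | φ p ∈? Bs ×-dec φ q ∈? Bs
      ...   | no φp≢φq | yes (p∈Bs , q∈Bs) =
                inj₂ (crossing (line-⊆ (there p∈) (there q∈) (here refl)) φp≢φq p∈Bs q∈Bs)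
      ...   | yes φp≡φq | _ = inj₁ λ where
                (here refl) → low-product (low p∈) (low q∈) (λ φp≢φq → contradiction φp≡φq φp≢φq)
                (there u∈)  → low u∈
      ...   | no _ | no not-both = inj₁ λ where
                (here refl) → low-product (low p∈) (low q∈) (λ _ → not-both)
                (there u∈)  → low u∈

      enlarge : ∀ {t} → Derivation (t ∷ support α) → (∀ {u} → u ∈ support α → Low u) →
        ψ t ≡ pt true (φ t) → Enlargement α t
      enlarge {t} d low high = record
        { support = t ∷ support α ; derivation = d ; target = doubled
        ; φ = ψ ; φ-hom = ψ-hom ; φ-injective = ψ-injective }
        , there , here refl
        where
        ψ-injective : InjectiveOn (t ∷ support α) ψ
        ψ-injective (here refl) (here refl) _  = refl
        ψ-injective (here refl) (there v∈) eq with () ← trans (sym high) (trans eq (low v∈))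
        ψ-injective (there u∈) (here refl) eq with () ← trans (sym (low u∈)) (trans eq high)
        ψ-injective (there u∈) (there v∈) eq =
          φ-injective α u∈ v∈ (proj₂ (pt-injective (trans (sym (low u∈)) (trans eq (low v∈)))))

    line-pullback : ∀ {v w z} → line v w ⊆ support α → z ∈ support α →
      φ z ∈ lineᴺ (φ v) (φ w) → z ∈ line v w
    line-pullback {v} {w} {z} L⊆ z∈ φz∈
      with s , s∈ , φz≡φs ← ∈-map⁻ φ (subst (φ z ∈_) (cong (λ r → φ v ∷ φ w ∷ r ∷ []) (sym (φ-hom v w))) φz∈) =
      subst (_∈ line v w) (sym (φ-injective α z∈ (L⊆ s∈) φz≡φs)) s∈

    crossing-contains-product : ∀ {p q v w} → p ∈ support α → q ∈ support α → line v w ⊆ support α →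
      φ v ≢ φ w → φ v ∈ lineᴺ (φ p) (φ q) → φ w ∈ lineᴺ (φ p) (φ q) → p · q ∈ support α
    crossing-contains-product {p} {q} {v} {w} p∈ q∈ L⊆ φv≢φw φv∈ φw∈ =
      L⊆ (line-closed (line-pullback L⊆ p∈ (⊆-line (here refl))) (line-pullback L⊆ q∈ (⊆-line (there (here refl)))))
      where
      ⊆-line : lineᴺ (φ p) (φ q) ⊆ lineᴺ (φ v) (φ w)
      ⊆-line = lineᴺ-⊆-lineᴺ φv∈ φw∈ φv≢φw

    add-generator : ∀ {x} → X x → Enlargement α x
    add-generator {x} x∈X = resolve (low-or-obstructed (derivation α))
      where
      open Lifting [] (λ ()) (λ y → isYes (y ≟ x))
      resolve : (∀ {u} → u ∈ support α → Low u) ⊎ Obstruction (support α) → Enlargement α x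
      resolve (inj₁ low) = enlarge (gen x∈X (derivation α)) low
        (trans (ψ-generator x∈X) (cong (λ b → pt b (φ x)) (trans (isYes≗does (x ≟ x)) (dec-true (x ≟ x) refl))))
      resolve (inj₂ (raised {y} y∈ y≡x)) = α , id , subst (_∈ support α) (toWitness {a? = y ≟ x} y≡x) y∈
      resolve (inj₂ (crossing _ _ () _))

    -- When φ p ≠ φ q, lifting along the line through them raises p · q, unless a crossing
    -- product of S maps onto that line, in which case p · q is already in S.
    add-product : ∀ {p q} → p ∈ support α → q ∈ support α → Enlargement α (p · q)
    add-product {p} {q} p∈ q∈ with φ p ≟ᴺ φ q
    ... | yes φp≡φq = α , id , subst (_∈ support α) (sym p·q≡p) p∈
      where
      p·q≡p : p · q ≡ p
      p·q≡p = trans (cong (p ·_) (φ-injective α q∈ p∈ (sym φp≡φq))) (idem p)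
    ... | no φp≢φq = resolve (low-or-obstructed (derivation α))
      where
      open Lifting (lineᴺ (φ p) (φ q)) lineᴺ-closed (λ _ → false)
      resolve : (∀ {u} → u ∈ support α → Low u) ⊎ Obstruction (support α) → Enlargement α (p · q)
      resolve (inj₁ low) = enlarge (mul p∈ q∈ (derivation α)) low (begin
        ψ (p · q)                       ≡⟨ ψ-hom p q ⟩
        ψ p ∙ ψ q                       ≡⟨ cong₂ _∙_ (low p∈) (low q∈) ⟩
        pt false (φ p) ∙ pt false (φ q) ≡⟨ raised-product φp≢φq (here refl) (there (here refl)) ⟩
        pt true (φ p ·ᴺ φ q)            ≡⟨ cong (pt true) (sym (φ-hom p q)) ⟩
        pt true (φ (p · q))             ∎)
        where open ≡-Reasoning
      resolve (inj₂ (raised _ ()))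
      resolve (inj₂ (crossing L⊆ φv≢φw φv∈ φw∈)) =
        α , id , crossing-contains-product p∈ q∈ L⊆ φv≢φw φv∈ φw∈

  add : (α : Approximation) → ∀ {t} → Gen M X t → Enlargement α t
  add α (base x∈X) = add-generator α x∈X
  add α (op g h) =
    let α₁ , ⊆₁ , s∈  = add α g
        α₂ , ⊆₂ , t∈  = add α₁ h
        α₃ , ⊆₃ , st∈ = add-product α₂ (⊆₂ s∈) t∈
    in α₃ , (λ z∈ → ⊆₃ (⊆₂ (⊆₁ z∈))) , st∈

  initial : Approximation
  initial = record
    { support = [] ; derivation = [] ; target = trivial
    ; φ = λ _ → tt ; φ-hom = λ _ _ → refl ; φ-injective = λ () }

  approximate : (ms : List (Carrier M)) → Σ Approximation λ α → ms ⊆ support α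
  approximate [] = initial , λ ()
  approximate (m ∷ ms) =
    let α , ms⊆ = approximate ms
        α′ , ⊆′ , m∈ = add α (proj₁ free m)
    in α′ , λ where
      (here refl) → m∈
      (there z∈)  → ⊆′ (ms⊆ z∈)

  residually-finite : (ms : List (Carrier M)) →
    Σ FiniteSteinerQuasigroup λ F → Σ (Carrier M → Carrier (quasigroup F)) λ φ →
      IsHom M (quasigroup F) φ × InjectiveOn ms φ
  residually-finite ms =
    let α , ms⊆ = approximate ms
    in target α , Approximation.φ α , Approximation.φ-hom α , λ u∈ v∈ → φ-injective α (ms⊆ u∈) (ms⊆ v∈)

corollary2p11 : (M : SteinerQuasigroup) → IsFree M → FinitelyGenerated M →
    (f : Carrier M → Carrier M) → IsHom M M f → Surjective M f →
    IsAutomorphism M f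
corollary2p11 M (X , free) (xs , xs-gen) f f-hom f-surj = f-hom , injective , f-surj
  where
  open Coding M xs xs-gen using (_≟_)
  injective : ∀ {a b} → f a ≡ f b → a ≡ b
  injective {a} {b} fa≡fb =
    let F , φ , φ-hom , φ-injective = ResidualFiniteness.residually-finite M free _≟_ (a ∷ b ∷ [])
        ψ , _ , φ≗ψ∘f = Hopfian.factor M free xs xs-gen f-hom f-surj F φ-hom
    in φ-injective (here refl) (there (here refl)) (begin
         φ a      ≡⟨ φ≗ψ∘f a ⟩
         ψ (f a)  ≡⟨ cong ψ fa≡fb ⟩
         ψ (f b)  ≡⟨ sym (φ≗ψ∘f b) ⟩
         φ b      ∎)
    where open ≡-Reasoning
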